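{- If $G$ is the block-intersection graph of a BIBD$(v,k,1)$ with replication number $r = \frac{v-1}{k-1}$, then $\sigma(G) = k(r-1)$.
   Context: Surrounding Cops and Robbers on a finite simple graph $G$ with $k \geq 1$ cops and one robber: the cops first choose starting vertices (several cops may share a vertex), then the robber chooses a starting vertex not occupied by a cop, and thereafter the cops and the robber alternate moves, the cops moving first. In a move, each player may move to an adjacent vertex or stay put; the robber may never move to, or remain on, a vertex occupied by a cop, so if a cop moves onto the robber's vertex the robber is compelled to move to a neighbouring vertex not occupied by a cop. The cops win if at any time every neighbour of the robber's vertex is occupied by a cop; the robber wins if he avoids this forever. Play is with perfect information. The surrounding cop number $\sigma(G)$ is the least number of cops for which the cops have a winning strategy. For integers $v > k \geq 2$, a BIBD$(v,k,1)$ is a pair $(X,\mathcal{B})$ with $|X|=v$ and $\mathcal{B}$ a collection of $k$-subsets (blocks) of $X$ such that every 2-subset of $X$ lies in exactly one block; each point then lies in exactly $r=\frac{v-1}{k-1}$ blocks (the replication number). The block-intersection graph has vertex set $\mathcal{B}$, with two distinct blocks adjacent iff they have nonempty intersection. -}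

module Defs where

open import Data.Nat using (ℕ; zero; suc; _∸_; _<_; _≤_; _*_)
open import Data.Fin using (Fin; toℕ)
open import Data.Fin.Subset using (Subset; _∈_; ∣_∣)
open import Data.List using (List; tabulate)
open import Data.Product using (Σ; ∃; _×_; _,_)
open import Data.Sum using (_⊎_)
open import Relation.Binary.PropositionalEquality using (_≡_; _≢_)
open import Relation.Nullary using (¬_)

record BIBD (v k : ℕ) : Set where
  field
    b        : ℕ
    block    : Fin b → Subset v
    k≥2      : 2 ≤ k
    v>k      : k < v
    blockSize : ∀ i → ∣ block i ∣ ≡ k
    pairCovered : ∀ (x y : Fin v) → x ≢ y →
                  ∃ λ (i : Fin b) → x ∈ block i × y ∈ block i
    pairUnique  : ∀ (x y : Fin v) → x ≢ y → ∀ (i j : Fin b) →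
                  x ∈ block i → y ∈ block i →
                  x ∈ block j → y ∈ block j → i ≡ j

BlockAdj : ∀ {v k} (D : BIBD v k) → Fin (BIBD.b D) → Fin (BIBD.b D) → Set
BlockAdj {v} D i j =
  i ≢ j × ∃ λ (x : Fin v) → x ∈ BIBD.block D i × x ∈ BIBD.block D j

module Game {n : ℕ} (Adj : Fin n → Fin n → Set) where

  Conf : ℕ → Set
  Conf m = Fin m → Fin n

  Surrounded : ∀ {m} → Conf m → Fin n → Set
  Surrounded c x = ∀ y → Adj x y → ∃ λ i → c i ≡ y

  -- a cop strategy: initial placement, and the next placement as a
  -- function of the robber's positions so far (r₀ , … , rₜ)
  record CopStrategy (m : ℕ) : Set where
    field
      start : Conf m
      move  : List (Fin n) → Conf m

  history : (ℕ → Fin n) → ℕ → List (Fin n)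
  history ρ t = tabulate {n = suc t} (λ i → ρ (toℕ i))

  copsAt : ∀ {m} → CopStrategy m → (ℕ → Fin n) → ℕ → Conf m
  copsAt S ρ zero    = CopStrategy.start S
  copsAt S ρ (suc t) = CopStrategy.move S (history ρ t)

  LegalCops : ∀ {m} → CopStrategy m → Set
  LegalCops {m} S = ∀ (ρ : ℕ → Fin n) (t : ℕ) (i : Fin m) →
    copsAt S ρ (suc t) i ≡ copsAt S ρ t i ⊎ Adj (copsAt S ρ t i) (copsAt S ρ (suc t) i)

  LegalRobber : ∀ {m} → CopStrategy m → (ℕ → Fin n) → Set
  LegalRobber {m} S ρ =
    (∀ (i : Fin m) → copsAt S ρ zero i ≢ ρ zero) ×
    (∀ (t : ℕ) → (ρ (suc t) ≡ ρ t ⊎ Adj (ρ t) (ρ (suc t))) ×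
                 (∀ (i : Fin m) → copsAt S ρ (suc t) i ≢ ρ (suc t)))

  -- cops win the play if the robber is surrounded at some time (after a
  -- robber move / placement, or after a cop move)
  CopsWinPlay : ∀ {m} → CopStrategy m → (ℕ → Fin n) → Set
  CopsWinPlay S ρ = ∃ λ (t : ℕ) →
    Surrounded (copsAt S ρ t) (ρ t) ⊎ Surrounded (copsAt S ρ (suc t)) (ρ t)

  CopsWin : ℕ → Set
  CopsWin m = Σ (CopStrategy m) λ S → LegalCops S ×
    (∀ (ρ : ℕ → Fin n) → LegalRobber S ρ → CopsWinPlay S ρ)

  SurroundingCopNumber : ℕ → Set
  SurroundingCopNumber s =
    1 ≤ s × CopsWin s × (∀ m → 1 ≤ m → m < s → ¬ CopsWin m)

-- The block-intersection graph is d-regular (by double counting), so fewer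
-- than d cops never occupy all neighbours of the robber: he stays put until
-- a cop lands on him and then steps to a free neighbour.  Conversely, d
-- cops start on the neighbours of a block X.  The robber cannot start
-- there; on X itself he is surrounded at once; on a block R disjoint from X
-- the cops move along a perfect matching between the neighbourhoods of X
-- and R in which matched blocks intersect, and so surround him.  This
-- matching exists by Hall's theorem, whose condition follows from a
-- weighted double count over the points outside X ∪ R.

module Submission where

open import Defs
open import Data.Nat using (ℕ; _∸_; _*_)
open import Relation.Binary.PropositionalEquality using (_≡_)

open import Data.Nat using (zero; suc; _+_; _≤_; _<_; z≤n; s≤s; _≤?_; >-nonZero)
open import Data.Nat.Properties hiding (_≟_; suc-injective)
open import Data.Bool using (Bool; true; false; _∧_; _∨_; not; T; if_then_else_)
open import Data.Fin using (Fin; zero; suc; toℕ; _≟_; fromℕ<)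
open import Data.Fin.Properties using (suc-injective; toℕ<n; toℕ-fromℕ<)
open import Data.List using (List; []; _∷_)
open import Data.List.Properties using (tabulate-cong)
open import Data.Product using (Σ; ∃; _×_; _,_; proj₁; proj₂)
open import Data.Sum using (_⊎_; inj₁; inj₂)
open import Data.Empty using (⊥; ⊥-elim)
open import Data.Unit using (tt)
open import Relation.Binary.PropositionalEquality using (_≢_; refl; sym; trans; cong; cong₂; subst; subst₂; module ≡-Reasoning)
open import Relation.Nullary using (¬_; Dec; yes; no)
open import Function using (_∘_)
open import Relation.Nullary.Decidable using (T?; ⌊_⌋; toWitness; fromWitness; map′; _×-dec_)
open import Data.Fin.Subset using (Subset; ∣_∣; _∈_)
open import Data.Fin.Subset.Properties using (anySubset?)
open import Data.Vec using (lookup; tabulate; []; _∷_)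
open import Data.Vec.Properties using (lookup∘tabulate; lookup⇒[]=; []=⇒lookup)
open import Algebra.Properties.CommutativeSemigroup +-commutativeSemigroup using (interchange)

T-∧ : ∀ {a b} → T a → T b → T (a ∧ b)
T-∧ {true} {true} _ _ = tt

T-∧₁ : ∀ {a b} → T (a ∧ b) → T a
T-∧₁ {true} _ = tt

T-∧₂ : ∀ {a b} → T (a ∧ b) → T b
T-∧₂ {true} {true} _ = tt

T-not : ∀ {a} → ¬ T a → T (not a)
T-not {false} _ = tt
T-not {true} f = f tt

T-not⁻ : ∀ {a} → T (not a) → ¬ T a
T-not⁻ {true} ()

≡true⇒T : ∀ {a} → a ≡ true → T a
≡true⇒T refl = tt

T⇒≡true : ∀ {a} → T a → a ≡ true
T⇒≡true {true} _ = refl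

≡false⇒¬T : ∀ {a} → a ≡ false → ¬ T a
≡false⇒¬T refl ()

_==_ : ∀ {n} → Fin n → Fin n → Bool
i == j = ⌊ i ≟ j ⌋

==⇒≡ : ∀ {n} {i j : Fin n} → T (i == j) → i ≡ j
==⇒≡ = toWitness

≡⇒== : ∀ {n} {i j : Fin n} → i ≡ j → T (i == j)
≡⇒== = fromWitness

sum : ∀ {n} → (Fin n → ℕ) → ℕ
sum {zero} f = 0
sum {suc n} f = f zero + sum (λ i → f (suc i))

ind : Bool → ℕ
ind true = 1
ind false = 0

ind-true : ∀ {a} → T a → ind a ≡ 1
ind-true {true} _ = refl

ind-false : ∀ {a} → ¬ T a → ind a ≡ 0
ind-false {false} _ = refl
ind-false {true} f = ⊥-elim (f tt)

count : ∀ {n} → (Fin n → Bool) → ℕ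
count P = sum (λ i → ind (P i))

sum-cong : ∀ {n} {f g : Fin n → ℕ} → (∀ i → f i ≡ g i) → sum f ≡ sum g
sum-cong {zero} p = refl
sum-cong {suc n} p = cong₂ _+_ (p zero) (sum-cong (λ i → p (suc i)))

sum-mono : ∀ {n} {f g : Fin n → ℕ} → (∀ i → f i ≤ g i) → sum f ≤ sum g
sum-mono {zero} p = z≤n
sum-mono {suc n} p = +-mono-≤ (p zero) (sum-mono (λ i → p (suc i)))

sum-+ : ∀ {n} (f g : Fin n → ℕ) → sum (λ i → f i + g i) ≡ sum f + sum g
sum-+ {zero} f g = refl
sum-+ {suc n} f g =
  trans (cong ((f zero + g zero) +_) (sum-+ (λ i → f (suc i)) (λ i → g (suc i))))
        (interchange (f zero) (g zero) _ _)

sum-zero : ∀ {n} → sum {n} (λ _ → 0) ≡ 0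
sum-zero {zero} = refl
sum-zero {suc n} = sum-zero {n}

sum-swap : ∀ {n m} (f : Fin n → Fin m → ℕ) →
  sum (λ i → sum (λ j → f i j)) ≡ sum (λ j → sum (λ i → f i j))
sum-swap {zero} {m} f = sym (sum-zero {m})
sum-swap {suc n} f = trans (cong (sum (f zero) +_) (sum-swap (λ i → f (suc i))))
                           (sym (sum-+ (f zero) (λ j → sum (λ i → f (suc i) j))))

sum-*ʳ : ∀ {n} (f : Fin n → ℕ) c → sum (λ i → f i * c) ≡ sum f * c
sum-*ʳ {zero} f c = refl
sum-*ʳ {suc n} f c = trans (cong (f zero * c +_) (sum-*ʳ (λ i → f (suc i)) c))
                           (sym (*-distribʳ-+ c (f zero) _))

count-mono : ∀ {n} {P Q : Fin n → Bool} → (∀ i → T (P i) → T (Q i)) → count P ≤ count Q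
count-mono p = sum-mono (λ i → ind-mono (p i))
  where
    ind-mono : ∀ {a b} → (T a → T b) → ind a ≤ ind b
    ind-mono {false} f = z≤n
    ind-mono {true} {true} f = ≤-refl
    ind-mono {true} {false} f = ⊥-elim (f tt)

count-split : ∀ {n} (P Q : Fin n → Bool) →
  count P ≡ count (λ i → P i ∧ Q i) + count (λ i → P i ∧ not (Q i))
count-split P Q = trans (sum-cong (λ i → ind-split (P i) (Q i)))
                        (sum-+ (λ i → ind (P i ∧ Q i)) (λ i → ind (P i ∧ not (Q i))))
  where
    ind-split : ∀ a b → ind a ≡ ind (a ∧ b) + ind (a ∧ not b)
    ind-split false b = refl
    ind-split true true = refl
    ind-split true false = refl

count≤size : ∀ {n} (P : Fin n → Bool) → count P ≤ n
count≤size {zero} P = z≤n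
count≤size {suc n} P = +-mono-≤ (ind≤1 (P zero)) (count≤size (λ i → P (suc i)))
  where
    ind≤1 : ∀ a → ind a ≤ 1
    ind≤1 false = z≤n
    ind≤1 true = ≤-refl

count-all : ∀ {n} → count {n} (λ _ → true) ≡ n
count-all {zero} = refl
count-all {suc n} = cong suc (count-all {n})

count-none : ∀ {n} {P : Fin n → Bool} → (∀ i → ¬ T (P i)) → count P ≡ 0
count-none {n} {P} none = trans (sum-cong (λ i → ind-false (none i))) (sum-zero {n})

count-pos : ∀ {n} {P : Fin n → Bool} (a : Fin n) → T (P a) → 1 ≤ count P
count-pos {P = P} zero t with P zero
... | true = s≤s z≤n
count-pos {P = P} (suc a) t = ≤-trans (count-pos {P = λ i → P (suc i)} a t) (m≤n+m _ (ind (P zero)))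

count-unique : ∀ {n} (P : Fin n → Bool) → (∀ i j → T (P i) → T (P j) → i ≡ j) → count P ≤ 1
count-unique {zero} P u = z≤n
count-unique {suc n} P u with P zero in eq
... | true = ≤-reflexive (cong suc (count-none {P = λ i → P (suc i)}
                (λ i t → 0≢1+n (cong toℕ (u zero (suc i) (≡true⇒T eq) t)))))
... | false = count-unique (λ i → P (suc i)) (λ i j s t → suc-injective (u (suc i) (suc j) s t))

count-one : ∀ {n} {P : Fin n → Bool} (a : Fin n) → T (P a) → (∀ j → T (P j) → j ≡ a) → count P ≡ 1
count-one {P = P} a t u =
  ≤-antisym (count-unique P (λ i j s s' → trans (u i s) (sym (u j s')))) (count-pos a t)

count-remove : ∀ {n} (P : Fin n → Bool) (a : Fin n) → T (P a) →
  count P ≡ suc (count (λ i → P i ∧ not (i == a)))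
count-remove P a t = trans (count-split P (λ i → i == a))
  (cong (_+ count (λ i → P i ∧ not (i == a)))
        (count-one {P = λ i → P i ∧ (i == a)} a (T-∧ t (≡⇒== refl)) (λ j s → ==⇒≡ (T-∧₂ {P j} s))))

count-≤-remove : ∀ {n} (P : Fin n → Bool) (a : Fin n) →
  count P ≤ suc (count (λ i → P i ∧ not (i == a)))
count-≤-remove P a = begin
    count P
      ≡⟨ count-split P (λ i → i == a) ⟩
    count (λ i → P i ∧ (i == a)) + count (λ i → P i ∧ not (i == a))
      ≤⟨ +-monoˡ-≤ _ (count-unique (λ i → P i ∧ (i == a))
           (λ i j s t → trans (==⇒≡ (T-∧₂ {P i} s)) (sym (==⇒≡ (T-∧₂ {P j} t))))) ⟩
    suc (count (λ i → P i ∧ not (i == a))) ∎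
  where open ≤-Reasoning

count-∨ : ∀ {n} (P Q : Fin n → Bool) → (∀ i → T (P i) → ¬ T (Q i)) →
  count (λ i → P i ∨ Q i) ≡ count P + count Q
count-∨ P Q disjoint = trans (sum-cong (λ i → ind-∨ (P i) (Q i) (disjoint i)))
                             (sum-+ (λ i → ind (P i)) (λ i → ind (Q i)))
  where
    ind-∨ : ∀ p q → (T p → ¬ T q) → ind (p ∨ q) ≡ ind p + ind q
    ind-∨ true true d = ⊥-elim (d tt tt)
    ind-∨ true false d = refl
    ind-∨ false q d = refl

search : ∀ {n} (P : Fin n → Bool) → (Σ (Fin n) λ i → T (P i)) ⊎ (∀ i → ¬ T (P i))
search {zero} P = inj₂ (λ ())
search {suc n} P with P zero in eq
... | true = inj₁ (zero , ≡true⇒T eq)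
... | false with search (λ i → P (suc i))
...   | inj₁ (i , t) = inj₁ (suc i , t)
...   | inj₂ f = inj₂ λ { zero → ≡false⇒¬T eq ; (suc i) → f i }

witness : ∀ {n} (P : Fin n → Bool) → 1 ≤ count P → Σ (Fin n) λ i → T (P i)
witness P h with search P
... | inj₁ w = w
... | inj₂ f = ⊥-elim (1+n≰n (subst (1 ≤_) (count-none f) h))

any : ∀ {n} → (Fin n → Bool) → Bool
any {zero} P = false
any {suc n} P = P zero ∨ any (λ i → P (suc i))

any-intro : ∀ {n} (P : Fin n → Bool) (a : Fin n) → T (P a) → T (any P)
any-intro P zero t with P zero
... | true = tt
any-intro P (suc a) t with P zero
... | true = tt
... | false = any-intro (λ i → P (suc i)) a t

any-elim : ∀ {n} (P : Fin n → Bool) → T (any P) → Σ (Fin n) λ i → T (P i)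
any-elim {suc n} P t with P zero in eq
... | true = zero , ≡true⇒T eq
... | false with any-elim (λ i → P (suc i)) t
...   | i , s = suc i , s

double-count : ∀ {n m} (R : Fin n → Fin m → Bool) →
  sum (λ i → count (R i)) ≡ sum (λ j → count (λ i → R i j))
double-count R = sum-swap (λ i j → ind (R i j))

sum-on : ∀ {n} (f : Fin n → ℕ) (P : Fin n → Bool) c →
  (∀ i → f i ≡ ind (P i) * c) → sum f ≡ count P * c
sum-on f P c h = trans (sum-cong h) (sum-*ʳ (λ i → ind (P i)) c)

count-ext : ∀ {n} {P Q : Fin n → Bool} → (∀ i → T (P i) → T (Q i)) → (∀ i → T (Q i) → T (P i)) →
  count P ≡ count Q
count-ext P⇒Q Q⇒P = ≤-antisym (count-mono P⇒Q) (count-mono Q⇒P)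

size-count : ∀ {n} (p : Subset n) → ∣ p ∣ ≡ count (lookup p)
size-count [] = refl
size-count (true ∷ p) = cong suc (size-count p)
size-count (false ∷ p) = size-count p

incidences : ∀ {n m} → (Fin n → Bool) → (Fin m → Bool) → (Fin n → Fin m → Bool) → ℕ
incidences P Q I = sum (λ i → count (λ j → P i ∧ (I i j ∧ Q j)))

incidences-rows : ∀ {n m} (P : Fin n → Bool) (Q : Fin m → Bool) (I : Fin n → Fin m → Bool) {a} →
  (∀ i → T (P i) → count (λ j → I i j ∧ Q j) ≡ a) → incidences P Q I ≡ count P * a
incidences-rows {m = m} P Q I {a} rows = sum-on _ P a row
  where
    row : ∀ i → count (λ j → P i ∧ (I i j ∧ Q j)) ≡ ind (P i) * a
    row i with P i in eq
    ... | true = trans (rows i (≡true⇒T eq)) (sym (+-identityʳ a))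
    ... | false = count-none {m} (λ j ())

column-in : ∀ {n m} (P : Fin n → Bool) (Q : Fin m → Bool) (I : Fin n → Fin m → Bool) j → T (Q j) →
  count (λ i → P i ∧ (I i j ∧ Q j)) ≡ count (λ i → P i ∧ I i j)
column-in P Q I j Qj =
  count-ext (λ i t → T-∧ {P i} (T-∧₁ {P i} t) (T-∧₁ {I i j} (T-∧₂ {P i} t)))
            (λ i t → T-∧ {P i} (T-∧₁ {P i} t) (T-∧ {I i j} (T-∧₂ {P i} t) Qj))

column-out : ∀ {n m} (P : Fin n → Bool) (Q : Fin m → Bool) (I : Fin n → Fin m → Bool) j → ¬ T (Q j) →
  count (λ i → P i ∧ (I i j ∧ Q j)) ≡ 0
column-out P Q I j ¬Qj = count-none (λ i t → ¬Qj (T-∧₂ {I i j} (T-∧₂ {P i} t)))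

incidences-columns : ∀ {n m} (P : Fin n → Bool) (Q : Fin m → Bool) (I : Fin n → Fin m → Bool) {c} →
  (∀ j → T (Q j) → count (λ i → P i ∧ I i j) ≡ c) → incidences P Q I ≡ count Q * c
incidences-columns P Q I {c} columns =
  trans (double-count (λ i j → P i ∧ (I i j ∧ Q j))) (sum-on _ Q c column)
  where
    column : ∀ j → count (λ i → P i ∧ (I i j ∧ Q j)) ≡ ind (Q j) * c
    column j with T? (Q j)
    ... | yes Qj = begin
      count (λ i → P i ∧ (I i j ∧ Q j)) ≡⟨ column-in P Q I j Qj ⟩
      count (λ i → P i ∧ I i j)         ≡⟨ columns j Qj ⟩
      c                                 ≡⟨ sym (*-identityˡ c) ⟩
      1 * c                             ≡⟨ cong (_* c) (sym (ind-true Qj)) ⟩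
      ind (Q j) * c                     ∎
      where open ≡-Reasoning
    ... | no ¬Qj = trans (column-out P Q I j ¬Qj) (cong (_* c) (sym (ind-false ¬Qj)))

incidences-compare : ∀ {n m} (P P' : Fin n → Bool) (Q : Fin m → Bool) (I : Fin n → Fin m → Bool) →
  (∀ j → T (Q j) → count (λ i → P i ∧ I i j) ≤ count (λ i → P' i ∧ I i j)) →
  incidences P Q I ≤ incidences P' Q I
incidences-compare P P' Q I columns = begin
    incidences P Q I
      ≡⟨ double-count (λ i j → P i ∧ (I i j ∧ Q j)) ⟩
    sum (λ j → count (λ i → P i ∧ (I i j ∧ Q j)))
      ≤⟨ sum-mono column ⟩
    sum (λ j → count (λ i → P' i ∧ (I i j ∧ Q j)))
      ≡⟨ sym (double-count (λ i j → P' i ∧ (I i j ∧ Q j))) ⟩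
    incidences P' Q I ∎
  where
    open ≤-Reasoning
    column : ∀ j → count (λ i → P i ∧ (I i j ∧ Q j)) ≤ count (λ i → P' i ∧ (I i j ∧ Q j))
    column j with T? (Q j)
    ... | yes Qj = subst₂ _≤_ (sym (column-in P Q I j Qj)) (sym (column-in P' Q I j Qj)) (columns j Qj)
    ... | no ¬Qj = ≤-trans (≤-reflexive (column-out P Q I j ¬Qj)) z≤n

injection-count : ∀ {n m} (f : Fin n → Fin m) (A : Fin n → Bool) (B : Fin m → Bool) →
  (∀ x → T (A x) → T (B (f x))) → (∀ x y → T (A x) → T (A y) → f x ≡ f y → x ≡ y) →
  count A ≤ count B
injection-count {n} {m} f A B into inj = begin
    count A                            ≡⟨ sym (*-identityʳ _) ⟩
    count A * 1                        ≡⟨ sym (sum-on _ A 1 row) ⟩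
    sum (λ x → count (graph x))        ≡⟨ double-count graph ⟩
    sum (λ y → count (λ x → graph x y)) ≤⟨ sum-mono column ⟩
    count B                            ∎
  where
    open ≤-Reasoning
    graph : Fin n → Fin m → Bool
    graph x y = A x ∧ (f x == y)
    row : ∀ x → count (graph x) ≡ ind (A x) * 1
    row x with A x
    ... | false = count-none {m} {λ _ → false} (λ y ())
    ... | true = count-one {P = λ y → f x == y} (f x) (≡⇒== refl) (λ j t → sym (==⇒≡ t))
    column : ∀ y → count (λ x → graph x y) ≤ ind (B y)
    column y with B y in eq
    ... | true = count-unique (λ x → graph x y) (λ i j ti tj → inj i j (T-∧₁ ti) (T-∧₁ tj)
                   (trans (==⇒≡ (T-∧₂ {A i} ti)) (sym (==⇒≡ (T-∧₂ {A j} tj)))))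
    ... | false = ≤-reflexive (count-none (λ x t → ≡false⇒¬T eq
                    (subst (λ z → T (B z)) (==⇒≡ (T-∧₂ {A x} t)) (into x (T-∧₁ t)))))

covering-count : ∀ {n m} (c : Fin m → Fin n) (P : Fin n → Bool) →
  (∀ y → T (P y) → ∃ λ i → c i ≡ y) → count P ≤ m
covering-count {n} {m} c P covers = begin
    count P                             ≤⟨ sum-mono row ⟩
    sum (λ y → count (hits y))          ≡⟨ double-count hits ⟩
    sum (λ i → count (λ y → hits y i))  ≤⟨ sum-mono column ⟩
    count {m} (λ _ → true)              ≡⟨ count-all {m} ⟩
    m                                   ∎
  where
    open ≤-Reasoning
    hits : Fin n → Fin m → Bool
    hits y i = P y ∧ (c i == y)
    row : ∀ y → ind (P y) ≤ count (hits y)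
    row y with P y in eq
    ... | false = z≤n
    ... | true with covers y (≡true⇒T eq)
    ...   | i , ci≡y = count-pos {P = λ i → c i == y} i (≡⇒== ci≡y)
    column : ∀ i → count (λ y → hits y i) ≤ ind true
    column i = count-unique (λ y → hits y i)
      (λ y y' t t' → trans (sym (==⇒≡ (T-∧₂ {P y} t))) (==⇒≡ (T-∧₂ {P y'} t')))

injection-onto : ∀ {n m} (f : Fin n → Fin m) (A : Fin n → Bool) (B : Fin m → Bool) →
  (∀ x → T (A x) → T (B (f x))) → (∀ x y → T (A x) → T (A y) → f x ≡ f y → x ≡ y) →
  count B ≤ count A → ∀ y → T (B y) → Σ (Fin n) λ x → T (A x) × f x ≡ y
injection-onto {m = m} f A B into inj B≤A y By with search (λ x → A x ∧ (f x == y))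
... | inj₁ (x , t) = x , T-∧₁ t , ==⇒≡ (T-∧₂ {A x} t)
... | inj₂ missed = ⊥-elim (1+n≰n (begin
    suc (count B-y)  ≡⟨ sym (count-remove B y By) ⟩
    count B          ≤⟨ B≤A ⟩
    count A          ≤⟨ injection-count f A B-y into-B-y inj ⟩
    count B-y        ∎))
  where
    open ≤-Reasoning
    B-y : Fin m → Bool
    B-y z = B z ∧ not (z == y)
    into-B-y : ∀ x → T (A x) → T (B-y (f x))
    into-B-y x t = T-∧ (into x t) (T-not (λ e → missed x (T-∧ t e)))

Enumeration : ∀ {n} → (Fin n → Bool) → ℕ → Set
Enumeration {n} P d = Σ (Fin d → Fin n) λ e →
  (∀ i → T (P (e i))) × (∀ x → T (P x) → ∃ λ i → e i ≡ x)

enumerate : ∀ {n} (P : Fin n → Bool) → Enumeration P (count P)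
enumerate {zero} P = (λ ()) , (λ ()) , (λ ())
enumerate {suc n} P with enumerate (λ i → P (suc i)) | P zero in eq
... | e , valid , complete | true = e' , valid' , complete'
  where
    e' : Fin (suc (count (λ i → P (suc i)))) → Fin (suc n)
    e' zero = zero
    e' (suc i) = suc (e i)
    valid' : ∀ i → T (P (e' i))
    valid' zero = ≡true⇒T eq
    valid' (suc i) = valid i
    complete' : ∀ x → T (P x) → ∃ λ i → e' i ≡ x
    complete' zero t = zero , refl
    complete' (suc x) t with complete x t
    ... | i , p = suc i , cong suc p
... | e , valid , complete | false = (λ i → suc (e i)) , valid , complete'
  where
    complete' : ∀ x → T (P x) → ∃ λ i → suc (e i) ≡ x
    complete' zero t = ⊥-elim (≡false⇒¬T eq t)
    complete' (suc x) t with complete x t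
    ... | i , p = i , cong suc p

-- The proof is the classical
-- induction on |A|: either some nonempty proper S ⊆ A is tight (exactly
-- enough neighbours), and A splits into S and A ∖ S, or no set is tight,
-- and any element of A can be matched to any of its neighbours.  The point
-- default only serves as the (irrelevant) value of matchings outside A.

module Hall {n m : ℕ} (E : Fin n → Fin m → Bool) (default : Fin m) where

  Nb : (Fin n → Bool) → Fin m → Bool
  Nb S y = any (λ x → S x ∧ E x y)

  Nb-intro : ∀ S x y → T (S x) → T (E x y) → T (Nb S y)
  Nb-intro S x y s e = any-intro (λ x → S x ∧ E x y) x (T-∧ s e)

  Nb-elim : ∀ S y → T (Nb S y) → Σ (Fin n) λ x → T (S x) × T (E x y)
  Nb-elim S y t with any-elim (λ x → S x ∧ E x y) t
  ... | x , u = x , T-∧₁ u , T-∧₂ u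

  Nb-mono : ∀ {S S'} → (∀ x → T (S x) → T (S' x)) → ∀ y → T (Nb S y) → T (Nb S' y)
  Nb-mono {S} {S'} S⊆S' y t with Nb-elim S y t
  ... | x , s , e = Nb-intro S' x y (S⊆S' x s) e

  _⊆_ : (Fin n → Bool) → (Fin n → Bool) → Set
  S ⊆ A = ∀ x → T (S x) → T (A x)

  NbIn : (Fin m → Bool) → (Fin n → Bool) → Fin m → Bool
  NbIn B S y = B y ∧ Nb S y

  HallCondition : (Fin n → Bool) → (Fin m → Bool) → Set
  HallCondition A B = ∀ S → S ⊆ A → count S ≤ count (NbIn B S)

  Matching : (Fin n → Bool) → (Fin m → Bool) → Set
  Matching A B = Σ (Fin n → Fin m) λ f →
    (∀ x → T (A x) → T (B (f x)) × T (E x (f x))) ×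
    (∀ x y → T (A x) → T (A y) → f x ≡ f y → x ≡ y)

  empty-matching : ∀ {A : Fin n → Bool} {B : Fin m → Bool} → (∀ x → ¬ T (A x)) → Matching A B
  empty-matching none = (λ _ → default) , (λ x t → ⊥-elim (none x t)) , (λ x y t → ⊥-elim (none x t))

  glue : ∀ {A B} (S : Fin n → Bool) (B₁ B₂ : Fin m → Bool) →
    (∀ y → T (B₁ y) → T (B y)) → (∀ y → T (B₂ y) → T (B y)) →
    (∀ y → T (B₁ y) → ¬ T (B₂ y)) →
    Matching (λ x → A x ∧ S x) B₁ → Matching (λ x → A x ∧ not (S x)) B₂ → Matching A B
  glue {A} {B} S B₁ B₂ B₁⊆B B₂⊆B disjoint (f₁ , ok₁ , inj₁⁺) (f₂ , ok₂ , inj₂⁺) = f , ok , inj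
    where
      f : Fin n → Fin m
      f x = if S x then f₁ x else f₂ x
      in₁ : ∀ {x} → T (A x) → S x ≡ true → T (A x ∧ S x)
      in₁ t eq = T-∧ t (≡true⇒T eq)
      in₂ : ∀ {x} → T (A x) → S x ≡ false → T (A x ∧ not (S x))
      in₂ t eq = T-∧ t (T-not (≡false⇒¬T eq))
      ok : ∀ x → T (A x) → T (B (f x)) × T (E x (f x))
      ok x t with S x in eq
      ... | true = B₁⊆B (f₁ x) (proj₁ (ok₁ x (in₁ t eq))) , proj₂ (ok₁ x (in₁ t eq))
      ... | false = B₂⊆B (f₂ x) (proj₁ (ok₂ x (in₂ t eq))) , proj₂ (ok₂ x (in₂ t eq))
      inj : ∀ x y → T (A x) → T (A y) → f x ≡ f y → x ≡ y
      inj x y tx ty fx≡fy with S x in ex | S y in ey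
      ... | true | true = inj₁⁺ x y (in₁ tx ex) (in₁ ty ey) fx≡fy
      ... | false | false = inj₂⁺ x y (in₂ tx ex) (in₂ ty ey) fx≡fy
      ... | true | false = ⊥-elim (disjoint _ (proj₁ (ok₁ x (in₁ tx ex)))
                                     (subst (λ z → T (B₂ z)) (sym fx≡fy) (proj₁ (ok₂ y (in₂ ty ey)))))
      ... | false | true = ⊥-elim (disjoint _ (proj₁ (ok₁ y (in₁ ty ey)))
                                     (subst (λ z → T (B₂ z)) fx≡fy (proj₁ (ok₂ x (in₂ tx ex)))))

  Tight : (Fin n → Bool) → (Fin m → Bool) → (Fin n → Bool) → Set
  Tight A B S = S ⊆ A × 1 ≤ count S × count S < count A × count (NbIn B S) ≤ count S

  _⊆?_ : ∀ S A → Dec (S ⊆ A)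
  S ⊆? A with search (λ x → S x ∧ not (A x))
  ... | inj₁ (x , t) = no (λ S⊆A → T-not⁻ (T-∧₂ {S x} t) (S⊆A x (T-∧₁ t)))
  ... | inj₂ none = yes included
    where
      included : S ⊆ A
      included x s with A x in eq
      ... | true = tt
      ... | false = none x (T-∧ s (T-not (≡false⇒¬T eq)))

  Tight? : ∀ A B S → Dec (Tight A B S)
  Tight? A B S = (S ⊆? A) ×-dec (1 ≤? count S) ×-dec (suc (count S) ≤? count A)
                 ×-dec (count (NbIn B S) ≤? count S)

  Tight-resp : ∀ {A B S S'} → S ⊆ S' → S' ⊆ S → Tight A B S → Tight A B S'
  Tight-resp {A} {B} {S} {S'} S⊆S' S'⊆S (S⊆A , nonempty , proper , no-surplus) =
    (λ x t → S⊆A x (S'⊆S x t)) ,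
    ≤-trans nonempty (count-mono S⊆S') ,
    ≤-trans (s≤s (count-mono S'⊆S)) proper ,
    ≤-trans (count-mono (λ y t → T-∧ (T-∧₁ t) (Nb-mono S'⊆S y (T-∧₂ {B y} t))))
            (≤-trans no-surplus (count-mono S⊆S'))

  tight? : ∀ A B → Dec (∃ λ S → Tight A B S)
  tight? A B = map′ (λ (V , t) → lookup V , t)
                    (λ (S , t) → tabulate S , Tight-resp (same S) (same' S) t)
                    (anySubset? (λ V → Tight? A B (lookup V)))
    where
      same : ∀ S x → T (S x) → T (lookup (tabulate S) x)
      same S x = subst T (sym (lookup∘tabulate S x))
      same' : ∀ S x → T (lookup (tabulate S) x) → T (S x)
      same' S x = subst T (lookup∘tabulate S x)

  hall-inside : ∀ {A B} S → HallCondition A B →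
    HallCondition (λ x → A x ∧ S x) (NbIn B S)
  hall-inside {A} {B} S hall U U⊆ = ≤-trans (hall U (λ x t → T-∧₁ (U⊆ x t)))
    (count-mono (λ y t → T-∧ (T-∧ (T-∧₁ t) (Nb-mono (λ x u → T-∧₂ {A x} (U⊆ x u)) y (T-∧₂ {B y} t)))
                              (T-∧₂ {B y} t)))

  hall-outside : ∀ {A B} S → S ⊆ A → count (NbIn B S) ≤ count S → HallCondition A B →
    HallCondition (λ x → A x ∧ not (S x)) (λ y → B y ∧ not (Nb S y))
  hall-outside {A} {B} S S⊆A no-surplus hall U U⊆ = +-cancelˡ-≤ (count S) _ _ (begin
      count S + count U
        ≡⟨ +-comm (count S) _ ⟩
      count U + count S
        ≡⟨ sym (count-∨ U S (λ x u → T-not⁻ (T-∧₂ {A x} (U⊆ x u)))) ⟩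
      count U∪S
        ≤⟨ hall U∪S U∪S⊆A ⟩
      count (NbIn B U∪S)
        ≡⟨ count-split (NbIn B U∪S) (Nb S) ⟩
      count (λ y → NbIn B U∪S y ∧ Nb S y) + count (λ y → NbIn B U∪S y ∧ not (Nb S y))
        ≤⟨ +-mono-≤ (≤-trans (count-mono (λ y t → T-∧ (T-∧₁ (T-∧₁ {NbIn B U∪S y} t))
                                                           (T-∧₂ {NbIn B U∪S y} t)))
                             no-surplus)
                    (count-mono new-neighbour) ⟩
      count S + count (NbIn (λ y → B y ∧ not (Nb S y)) U) ∎)
    where
      open ≤-Reasoning
      U∪S : Fin n → Bool
      U∪S x = U x ∨ S x
      U∪S⊆A : U∪S ⊆ A
      U∪S⊆A x t with U x in eu
      ... | true = T-∧₁ (U⊆ x (≡true⇒T eu))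
      ... | false = S⊆A x t
      new-neighbour : ∀ y → T (NbIn B U∪S y ∧ not (Nb S y)) →
                      T (NbIn (λ y → B y ∧ not (Nb S y)) U y)
      new-neighbour y t with Nb-elim U∪S y (T-∧₂ {B y} (T-∧₁ t))
      ... | x , u∨s , e with U x in eu
      ... | true = T-∧ (T-∧ (T-∧₁ (T-∧₁ t)) (T-∧₂ {NbIn B U∪S y} t)) (Nb-intro U x y (≡true⇒T eu) e)
      ... | false = ⊥-elim (T-not⁻ (T-∧₂ {NbIn B U∪S y} t) (Nb-intro S x y u∨s e))

  hall-remove : ∀ {A B} a y₀ → T (A a) → HallCondition A B → ¬ (∃ λ S → Tight A B S) →
    HallCondition (λ x → A x ∧ not (x == a)) (λ y → B y ∧ not (y == y₀))
  hall-remove {A} {B} a y₀ Aa hall no-tight S S⊆ with search S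
  ... | inj₂ none = ≤-trans (≤-reflexive (count-none none)) z≤n
  ... | inj₁ (x , Sx) = ≤-pred (begin
      suc (count S)
        ≤⟨ ≰⇒> (λ no-surplus → no-tight (S , S⊆A , count-pos x Sx , proper , no-surplus)) ⟩
      count (NbIn B S)
        ≤⟨ count-≤-remove (NbIn B S) y₀ ⟩
      suc (count (λ y → NbIn B S y ∧ not (y == y₀)))
        ≤⟨ s≤s (count-mono (λ y t → T-∧ (T-∧ (T-∧₁ (T-∧₁ t)) (T-∧₂ {NbIn B S y} t))
                                          (T-∧₂ {B y} (T-∧₁ t)))) ⟩
      suc (count (NbIn (λ y → B y ∧ not (y == y₀)) S)) ∎)
    where
      open ≤-Reasoning
      S⊆A : S ⊆ A
      S⊆A x t = T-∧₁ (S⊆ x t)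
      proper : count S < count A
      proper = begin-strict
        count S                                 ≤⟨ count-mono S⊆ ⟩
        count (λ x → A x ∧ not (x == a))        <⟨ n<1+n _ ⟩
        suc (count (λ x → A x ∧ not (x == a)))  ≡⟨ sym (count-remove A a Aa) ⟩
        count A                                 ∎

  singleton-matching : ∀ {A : Fin n → Bool} a y₀ → T (E a y₀) →
    Matching (λ x → A x ∧ (x == a)) (λ y → y == y₀)
  singleton-matching {A} a y₀ Ea = (λ _ → y₀) , valid , unique
    where
      is-a : ∀ x → T (A x ∧ (x == a)) → x ≡ a
      is-a x t = ==⇒≡ (T-∧₂ {A x} t)
      valid : ∀ x → T (A x ∧ (x == a)) → T (y₀ == y₀) × T (E x y₀)
      valid x t = ≡⇒== refl , subst (λ z → T (E z y₀)) (sym (is-a x t)) Ea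
      unique : ∀ x y → T (A x ∧ (x == a)) → T (A y ∧ (y == a)) → y₀ ≡ y₀ → x ≡ y
      unique x y s t _ = trans (is-a x s) (sym (is-a y t))

  Matchable : ℕ → Set
  Matchable c = ∀ A B → count A ≤ c → HallCondition A B → Matching A B

  split-at-tight : ∀ {c A B} → Matchable c → count A ≤ suc c → HallCondition A B →
    ∀ S → Tight A B S → Matching A B
  split-at-tight {c} {A} {B} matchable A≤c hc S (S⊆A , nonempty , proper , no-surplus) =
    glue {A} {B} S (NbIn B S) (λ y → B y ∧ not (Nb S y))
         (λ y → T-∧₁ {B y}) (λ y → T-∧₁ {B y}) (λ y t u → T-not⁻ (T-∧₂ {B y} u) (T-∧₂ {B y} t))
         (matchable (λ x → A x ∧ S x) (NbIn B S) inside-bound (hall-inside S hc))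
         (matchable (λ x → A x ∧ not (S x)) (λ y → B y ∧ not (Nb S y)) outside-bound
                    (hall-outside S S⊆A no-surplus hc))
    where
      open ≤-Reasoning
      inside-bound : count (λ x → A x ∧ S x) ≤ c
      inside-bound = ≤-pred (begin-strict
        count (λ x → A x ∧ S x) ≤⟨ count-mono (λ x → T-∧₂ {A x}) ⟩
        count S                 <⟨ proper ⟩
        count A                 ≤⟨ A≤c ⟩
        suc c                   ∎)
      outside-bound : count (λ x → A x ∧ not (S x)) ≤ c
      outside-bound = ≤-pred (begin
        suc (count (λ x → A x ∧ not (S x)))
          ≤⟨ +-monoˡ-≤ _ (≤-trans nonempty (count-mono (λ x s → T-∧ (S⊆A x s) s))) ⟩
        count (λ x → A x ∧ S x) + count (λ x → A x ∧ not (S x))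
          ≡⟨ sym (count-split A S) ⟩
        count A
          ≤⟨ A≤c ⟩
        suc c ∎)

  match-one : ∀ {c A B} → Matchable c → count A ≤ suc c → HallCondition A B →
    ¬ (∃ λ S → Tight A B S) → ∀ a → T (A a) → Matching A B
  match-one {c} {A} {B} matchable A≤c hc no-tight a Aa =
    glue {A} {B} only-a (λ y → y == y₀) (λ y → B y ∧ not (y == y₀))
         (λ y t → subst (λ z → T (B z)) (sym (==⇒≡ t)) By₀) (λ y → T-∧₁ {B y})
         (λ y t u → T-not⁻ (T-∧₂ {B y} u) t)
         (singleton-matching {A} a y₀ Ea)
         (matchable (λ x → A x ∧ not (x == a)) (λ y → B y ∧ not (y == y₀)) rest-bound
                    (hall-remove a y₀ Aa hc no-tight))
    where
      only-a : Fin n → Bool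
      only-a x = x == a
      -- by Hall's condition for {a}, the element a has a neighbour y₀ in B
      neighbour : Σ (Fin m) λ y → T (NbIn B only-a y)
      neighbour = witness (NbIn B only-a)
        (≤-trans (count-pos {P = only-a} a (≡⇒== refl))
                 (hc only-a (λ x t → subst (λ z → T (A z)) (sym (==⇒≡ t)) Aa)))
      y₀ : Fin m
      y₀ = proj₁ neighbour
      By₀ : T (B y₀)
      By₀ = T-∧₁ (proj₂ neighbour)
      Ea : T (E a y₀)
      Ea with Nb-elim only-a y₀ (T-∧₂ {B y₀} (proj₂ neighbour))
      ... | x , x==a , e = subst (λ z → T (E z y₀)) (==⇒≡ x==a) e
      rest-bound : count (λ x → A x ∧ not (x == a)) ≤ c
      rest-bound = ≤-pred (≤-trans (≤-reflexive (sym (count-remove A a Aa))) A≤c)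

  hall : ∀ c → Matchable c
  hall zero A B A≤0 hc = empty-matching {A} {B} (λ x t → 1+n≰n (≤-trans (count-pos x t) A≤0))
  hall (suc c) A B A≤c hc with tight? A B | search A
  ... | yes (S , tight) | _ = split-at-tight (hall c) A≤c hc S tight
  ... | no no-tight | inj₁ (a , Aa) = match-one (hall c) A≤c hc no-tight a Aa
  ... | no _ | inj₂ none = empty-matching {A} {B} none

module Surrounding {n : ℕ} (Adj : Fin n → Fin n → Set) (adj : Fin n → Fin n → Bool)
  (adj-sound : ∀ {x y} → T (adj x y) → Adj x y)
  (adj-complete : ∀ {x y} → Adj x y → T (adj x y)) where

  open Game Adj

  degree : Fin n → ℕ
  degree x = count (adj x)

  surround-needs : ∀ {m} (c : Conf m) x → Surrounded c x → degree x ≤ m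
  surround-needs c x surrounded = covering-count c (adj x) (λ y t → surrounded y (adj-sound t))

  occupied : ∀ {m} → Conf m → Fin n → Bool
  occupied c y = any (λ i → c i == y)

  free-neighbour : ∀ {m} (c : Conf m) x → m < degree x →
    Σ (Fin n) λ y → Adj x y × (∀ i → c i ≢ y)
  free-neighbour c x few with search (λ y → adj x y ∧ not (occupied c y))
  ... | inj₁ (y , t) = y , adj-sound (T-∧₁ t) ,
        λ i ci≡y → T-not⁻ (T-∧₂ {adj x y} t) (any-intro (λ i → c i == y) i (≡⇒== ci≡y))
  ... | inj₂ none = ⊥-elim (<⇒≱ few (surround-needs c x all-occupied))
    where
      all-occupied : Surrounded c x
      all-occupied y a with occupied c y in eq
      ... | true = let (i , t) = any-elim (λ i → c i == y) (≡true⇒T eq) in i , ==⇒≡ t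
      ... | false = ⊥-elim (none y (T-∧ (adj-complete a) (T-not (≡false⇒¬T eq))))

  -- The robber stays put unless a cop lands on him, and then flees
  -- to a cop-free neighbour; he is never surrounded, by surround-needs.
  module Evasion {m d : ℕ} (x₀ : Fin n) (min-degree : ∀ x → d ≤ degree x) (m<d : m < d) where

    few : ∀ x → m < degree x
    few x = ≤-trans m<d (min-degree x)

    flee : Conf m → Fin n → Fin n
    flee c x with occupied c x
    ... | true = proj₁ (free-neighbour c x (few x))
    ... | false = x

    flee-legal : ∀ c x → (flee c x ≡ x ⊎ Adj x (flee c x)) × (∀ i → c i ≢ flee c x)
    flee-legal c x with occupied c x in eq
    ... | true = inj₂ (proj₁ (proj₂ (free-neighbour c x (few x)))) ,
                 proj₂ (proj₂ (free-neighbour c x (few x)))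
    ... | false = inj₁ refl ,
                  λ i ci≡x → ≡false⇒¬T eq (any-intro (λ i → c i == x) i (≡⇒== ci≡x))

    module AgainstStrategy (S : CopStrategy m) where
      open CopStrategy S

      start-vertex : Fin n
      start-vertex = proj₁ (free-neighbour start x₀ (few x₀))

      -- stage t s is the robber's position at time s as known at time t;
      -- it is frozen for s ≤ t, which makes the history well defined.
      stage : ℕ → ℕ → Fin n
      stage zero s = start-vertex
      stage (suc t) s with s ≤? t
      ... | yes _ = stage t s
      ... | no _ = flee (move (history (stage t) t)) (stage t t)

      stage-new : ∀ t → stage (suc t) (suc t) ≡ flee (move (history (stage t) t)) (stage t t)
      stage-new t with suc t ≤? t
      ... | yes t<t = ⊥-elim (1+n≰n t<t)
      ... | no _ = refl

      stage-frozen : ∀ t s → s ≤ t → stage t s ≡ stage s s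
      stage-frozen zero zero z≤n = refl
      stage-frozen (suc t) s s≤1+t with s ≤? t
      ... | yes s≤t = stage-frozen t s s≤t
      ... | no s≰t with ≤-antisym s≤1+t (≰⇒> s≰t)
      ...   | refl = sym (stage-new t)

      play : ℕ → Fin n
      play t = stage t t

      history-frozen : ∀ t → history play t ≡ history (stage t) t
      history-frozen t = tabulate-cong (λ i → sym (stage-frozen t (toℕ i) (≤-pred (toℕ<n i))))

      play-flees : ∀ t → play (suc t) ≡ flee (copsAt S play (suc t)) (play t)
      play-flees t = trans (stage-new t) (cong (λ h → flee (move h) (play t)) (sym (history-frozen t)))

      play-legal : LegalRobber S play
      play-legal = proj₂ (proj₂ (free-neighbour start x₀ (few x₀))) , λ t →
        subst (λ z → (z ≡ play t ⊎ Adj (play t) z) × (∀ i → copsAt S play (suc t) i ≢ z))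
              (sym (play-flees t)) (flee-legal (copsAt S play (suc t)) (play t))

    fewer-cops-lose : ¬ CopsWin m
    fewer-cops-lose (S , _ , wins) = never-surrounded (wins play play-legal)
      where
        open AgainstStrategy S
        never-surrounded : ¬ CopsWinPlay S play
        never-surrounded (t , inj₁ surrounded) = <⇒≱ (few _) (surround-needs _ _ surrounded)
        never-surrounded (t , inj₂ surrounded) = <⇒≱ (few _) (surround-needs _ _ surrounded)

  Redeployable : Fin n → Fin n → Set
  Redeployable x₀ R = Σ (Fin n → Fin n) λ φ →
    (∀ C → Adj x₀ C → φ C ≡ C ⊎ Adj C (φ C)) ×
    (∀ D → Adj R D → ∃ λ C → Adj x₀ C × φ C ≡ D)

  -- The cops start on the neighbours of x₀; the robber cannot start there,
  -- is surrounded at once on x₀, and is surrounded after one move otherwise.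
  module OneMoveWin (x₀ : Fin n)
    (redeploy : ∀ R → R ≢ x₀ → ¬ Adj x₀ R → Redeployable x₀ R) where

    listing : Enumeration (adj x₀) (degree x₀)
    listing = enumerate (adj x₀)

    initial : Conf (degree x₀)
    initial = proj₁ listing

    initial-listing : ∀ C → Adj x₀ C → ∃ λ i → initial i ≡ C
    initial-listing C a = proj₂ (proj₂ listing) C (adj-complete a)

    initial-adjacent : ∀ i → Adj x₀ (initial i)
    initial-adjacent i = adj-sound (proj₁ (proj₂ listing) i)

    data Position (R : Fin n) : Set where
      centre : R ≡ x₀ → Position R
      near   : Adj x₀ R → Position R
      far    : R ≢ x₀ → ¬ Adj x₀ R → Position R

    position : ∀ R → Position R
    position R with R ≟ x₀ | adj x₀ R in eq
    ... | yes R≡x₀ | _ = centre R≡x₀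
    ... | no _ | true = near (adj-sound (≡true⇒T eq))
    ... | no R≢x₀ | false = far R≢x₀ (≡false⇒¬T eq ∘ adj-complete)

    respond-at : ∀ R → Position R → Conf (degree x₀)
    respond-at R (far R≢x₀ ¬x₀R) = λ i → proj₁ (redeploy R R≢x₀ ¬x₀R) (initial i)
    respond-at R _ = initial

    respond-good : ∀ R (p : Position R) →
      (∀ i → respond-at R p i ≡ initial i ⊎ Adj (initial i) (respond-at R p i)) ×
      ((∀ i → initial i ≢ R) → Surrounded initial R ⊎ Surrounded (respond-at R p) R)
    respond-good R (centre refl) = (λ i → inj₁ refl) , λ _ → inj₁ initial-listing
    respond-good R (near x₀R) = (λ i → inj₁ refl) ,
      λ free → ⊥-elim (let (i , i↦R) = initial-listing R x₀R in free i i↦R)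
    respond-good R (far R≢x₀ ¬x₀R) = (λ i → moves (initial i) (initial-adjacent i)) , λ _ → inj₂ covered
      where
        φ : Fin n → Fin n
        φ = proj₁ (redeploy R R≢x₀ ¬x₀R)
        moves : ∀ C → Adj x₀ C → φ C ≡ C ⊎ Adj C (φ C)
        moves = proj₁ (proj₂ (redeploy R R≢x₀ ¬x₀R))
        covered : Surrounded (λ i → φ (initial i)) R
        covered D a with proj₂ (proj₂ (redeploy R R≢x₀ ¬x₀R)) D a
        ... | C , x₀C , φC≡D with initial-listing C x₀C
        ...   | i , i↦C = i , trans (cong φ i↦C) φC≡D

    strategy : CopStrategy (degree x₀)
    strategy = record { start = initial ; move = answer }
      where
        answer : List (Fin n) → Conf (degree x₀)
        answer [] = initial
        answer (R ∷ _) = respond-at R (position R)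

    strategy-legal : LegalCops strategy
    strategy-legal ρ zero i = proj₁ (respond-good (ρ 0) (position (ρ 0))) i
    strategy-legal ρ (suc t) i = inj₁ refl

    strategy-wins : ∀ ρ → LegalRobber strategy ρ → CopsWinPlay strategy ρ
    strategy-wins ρ (free , _) = 0 , proj₂ (respond-good (ρ 0) (position (ρ 0))) free

    cops-win : CopsWin (degree x₀)
    cops-win = strategy , strategy-legal , strategy-wins

  surrounding-cop-number : ∀ {d} (x₀ : Fin n) → 1 ≤ d → (∀ x → degree x ≡ d) →
    (∀ R → R ≢ x₀ → ¬ Adj x₀ R → Redeployable x₀ R) → SurroundingCopNumber d
  surrounding-cop-number x₀ d≥1 regular redeploy =
    d≥1 ,
    subst CopsWin (regular x₀) (OneMoveWin.cops-win x₀ redeploy) ,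
    λ m _ m<d → Evasion.fewer-cops-lose x₀ (λ x → ≤-reflexive (sym (regular x))) m<d

module BlockDesign {v k : ℕ} (D : BIBD v k) (r : ℕ) (replication : (k ∸ 1) * r ≡ v ∸ 1) where

  open BIBD D

  mem : Fin v → Fin b → Bool
  mem x i = lookup (block i) x

  mem⇒∈ : ∀ {x i} → T (mem x i) → x ∈ block i
  mem⇒∈ {x} {i} t = lookup⇒[]= x (block i) (T⇒≡true t)

  ∈⇒mem : ∀ {x i} → x ∈ block i → T (mem x i)
  ∈⇒mem {x} {i} x∈i = ≡true⇒T ([]=⇒lookup x∈i)

  block-size : ∀ i → count (λ x → mem x i) ≡ k
  block-size i = trans (sym (size-count (block i))) (blockSize i)

  k≥1 : 1 ≤ k
  k≥1 = ≤-trans (s≤s z≤n) k≥2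

  k-1≥1 : 1 ≤ k ∸ 1
  k-1≥1 = ∸-monoˡ-≤ 1 k≥2

  joining-block : ∀ x y → x ≢ y → Σ (Fin b) λ i → T (mem x i) × T (mem y i)
  joining-block x y x≢y with pairCovered x y x≢y
  ... | i , x∈i , y∈i = i , ∈⇒mem x∈i , ∈⇒mem y∈i

  joining-unique : ∀ {x y i j} → x ≢ y → T (mem x i) → T (mem y i) → T (mem x j) → T (mem y j) → i ≡ j
  joining-unique {x} {y} {i} {j} x≢y xi yi xj yj =
    pairUnique x y x≢y i j (mem⇒∈ xi) (mem⇒∈ yi) (mem⇒∈ xj) (mem⇒∈ yj)

  meet : Fin b → Fin b → Bool
  meet i j = any (λ x → mem x i ∧ mem x j)

  meet-intro : ∀ {i j} x → T (mem x i) → T (mem x j) → T (meet i j)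
  meet-intro {i} {j} x xi xj = any-intro (λ x → mem x i ∧ mem x j) x (T-∧ xi xj)

  meet-elim : ∀ {i j} → T (meet i j) → Σ (Fin v) λ x → T (mem x i) × T (mem x j)
  meet-elim {i} {j} t with any-elim (λ x → mem x i ∧ mem x j) t
  ... | x , u = x , T-∧₁ u , T-∧₂ u

  meet-sym : ∀ {i j} → T (meet i j) → T (meet j i)
  meet-sym t with meet-elim t
  ... | x , xi , xj = meet-intro x xj xi

  meet-refl : ∀ i → T (meet i i)
  meet-refl i with witness (λ x → mem x i) (subst (1 ≤_) (sym (block-size i)) k≥1)
  ... | x , xi = meet-intro x xi xi

  common-unique : ∀ {i j x y} → i ≢ j → T (mem x i) → T (mem x j) → T (mem y i) → T (mem y j) → x ≡ y
  common-unique {x = x} {y} i≢j xi xj yi yj with x ≟ y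
  ... | yes x≡y = x≡y
  ... | no x≢y = ⊥-elim (i≢j (joining-unique x≢y xi yi xj yj))

  common-one : ∀ {i j} → i ≢ j → T (meet i j) → count (λ x → mem x i ∧ mem x j) ≡ 1
  common-one {i} {j} i≢j t with meet-elim t
  ... | x , xi , xj = count-one x (T-∧ xi xj)
        (λ y u → common-unique i≢j (T-∧₁ u) (T-∧₂ {mem y i} u) xi xj)

  nbr : Fin b → Fin b → Bool
  nbr i j = not (i == j) ∧ meet i j

  nbr-intro : ∀ {i j} → i ≢ j → T (meet i j) → T (nbr i j)
  nbr-intro i≢j t = T-∧ (T-not (λ e → i≢j (==⇒≡ e))) t

  nbr-meet : ∀ {i j} → T (nbr i j) → T (meet i j)
  nbr-meet {i} {j} t = T-∧₂ {not (i == j)} t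

  nbr-distinct : ∀ {i j} → T (nbr i j) → i ≢ j
  nbr-distinct {i} {j} t i≡j = T-not⁻ (T-∧₁ t) (≡⇒== i≡j)

  nbr-sound : ∀ {i j} → T (nbr i j) → BlockAdj D i j
  nbr-sound {i} {j} t with meet-elim {i} {j} (nbr-meet {i} t)
  ... | x , xi , xj = nbr-distinct {i} t , x , mem⇒∈ xi , mem⇒∈ xj

  nbr-complete : ∀ {i j} → BlockAdj D i j → T (nbr i j)
  nbr-complete (i≢j , x , x∈i , x∈j) = nbr-intro i≢j (meet-intro x (∈⇒mem x∈i) (∈⇒mem x∈j))

  -- every point lies on exactly r blocks: count the pairs (block i ∋ q,
  -- point y ≠ q on i) by blocks (k - 1 each) and by points (one each)
  replication-number : ∀ q → count (λ i → mem q i) ≡ r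
  replication-number q = *-cancelʳ-≡ _ r (k ∸ 1) {{>-nonZero k-1≥1}} (begin
      count (λ i → mem q i) * (k ∸ 1)
        ≡⟨ sym (incidences-rows through-q other-point on rows) ⟩
      incidences through-q other-point on
        ≡⟨ incidences-columns through-q other-point on columns ⟩
      count other-point * 1
        ≡⟨ *-identityʳ _ ⟩
      count other-point
        ≡⟨ cong (_∸ 1) (trans (sym (count-remove (λ _ → true) q tt)) (count-all {v})) ⟩
      v ∸ 1
        ≡⟨ sym replication ⟩
      (k ∸ 1) * r
        ≡⟨ *-comm (k ∸ 1) r ⟩
      r * (k ∸ 1) ∎)
    where
      open ≡-Reasoning
      through-q : Fin b → Bool
      through-q i = mem q i
      other-point : Fin v → Bool
      other-point y = not (y == q)
      on : Fin b → Fin v → Bool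
      on i y = mem y i
      rows : ∀ i → T (through-q i) → count (λ y → on i y ∧ other-point y) ≡ k ∸ 1
      rows i qi = cong (_∸ 1) (trans (sym (count-remove (λ y → mem y i) q qi)) (block-size i))
      columns : ∀ y → T (other-point y) → count (λ i → through-q i ∧ on i y) ≡ 1
      columns y y≢q with joining-block q y (λ q≡y → T-not⁻ y≢q (≡⇒== (sym q≡y)))
      ... | i , qi , yi = count-one i (T-∧ qi yi)
            (λ j t → joining-unique (λ q≡y → T-not⁻ y≢q (≡⇒== (sym q≡y))) (T-∧₁ t) (T-∧₂ {mem q j} t) qi yi)

  -- the block-intersection graph is regular of degree k(r-1): count the
  -- pairs (neighbour C of X, point q ∈ C ∩ X) by neighbours (one common
  -- point each) and by points of X (r - 1 other blocks each)
  degree-nbr : ∀ X → count (nbr X) ≡ k * (r ∸ 1)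
  degree-nbr X = begin
      count (nbr X)                      ≡⟨ sym (*-identityʳ _) ⟩
      count (nbr X) * 1                  ≡⟨ sym (incidences-rows (nbr X) on-X on rows) ⟩
      incidences (nbr X) on-X on         ≡⟨ incidences-columns (nbr X) on-X on columns ⟩
      count on-X * (r ∸ 1)               ≡⟨ cong (_* (r ∸ 1)) (block-size X) ⟩
      k * (r ∸ 1)                        ∎
    where
      open ≡-Reasoning
      on-X : Fin v → Bool
      on-X q = mem q X
      on : Fin b → Fin v → Bool
      on C q = mem q C
      rows : ∀ C → T (nbr X C) → count (λ q → mem q C ∧ mem q X) ≡ 1
      rows C t = common-one (λ C≡X → nbr-distinct {X} t (sym C≡X)) (meet-sym (nbr-meet {X} t))
      columns : ∀ q → T (on-X q) → count (λ C → nbr X C ∧ mem q C) ≡ r ∸ 1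
      columns q qX = begin
        count (λ C → nbr X C ∧ mem q C)
          ≡⟨ count-ext (λ C t → T-∧ (T-∧₂ {nbr X C} t) (T-not (λ C==X → nbr-distinct {X} (T-∧₁ t) (sym (==⇒≡ C==X)))))
                       (λ C t → T-∧ (nbr-intro (λ X≡C → T-not⁻ (T-∧₂ {mem q C} t) (≡⇒== (sym X≡C)))
                                                (meet-intro q qX (T-∧₁ t)))
                                     (T-∧₁ t)) ⟩
        count (λ C → mem q C ∧ not (C == X))
          ≡⟨ cong (_∸ 1) (trans (sym (count-remove (λ C → mem q C) X qX)) (replication-number q)) ⟩
        r ∸ 1 ∎

  -- a point z off a block Y lies on exactly k blocks meeting Y: one
  -- through z and each point of Y
  through-meeting : ∀ z Y → ¬ T (mem z Y) → count (λ C → mem z C ∧ meet C Y) ≡ k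
  through-meeting z Y z∉Y = begin
      count through-z-meeting-Y          ≡⟨ sym (*-identityʳ _) ⟩
      count through-z-meeting-Y * 1      ≡⟨ sym (incidences-rows through-z-meeting-Y on-Y on rows) ⟩
      incidences through-z-meeting-Y on-Y on
                                         ≡⟨ incidences-columns through-z-meeting-Y on-Y on columns ⟩
      count on-Y * 1                     ≡⟨ *-identityʳ _ ⟩
      count on-Y                         ≡⟨ block-size Y ⟩
      k                                  ∎
    where
      open ≡-Reasoning
      through-z-meeting-Y : Fin b → Bool
      through-z-meeting-Y C = mem z C ∧ meet C Y
      on-Y : Fin v → Bool
      on-Y q = mem q Y
      on : Fin b → Fin v → Bool
      on C q = mem q C
      rows : ∀ C → T (through-z-meeting-Y C) → count (λ q → mem q C ∧ mem q Y) ≡ 1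
      rows C t = common-one (λ C≡Y → z∉Y (subst (λ B → T (mem z B)) C≡Y (T-∧₁ t))) (T-∧₂ {mem z C} t)
      z≢ : ∀ q → T (on-Y q) → z ≢ q
      z≢ q qY z≡q = z∉Y (subst (λ x → T (mem x Y)) (sym z≡q) qY)
      columns : ∀ q → T (on-Y q) → count (λ C → through-z-meeting-Y C ∧ mem q C) ≡ 1
      columns q qY with joining-block z q (z≢ q qY)
      ... | C , zC , qC = count-one C (T-∧ (T-∧ zC (meet-intro q qC qY)) qC)
            (λ j t → joining-unique (z≢ q qY) (T-∧₁ (T-∧₁ t)) (T-∧₂ {through-z-meeting-Y j} t) zC qC)

  outside-points : ∀ Y W → ¬ T (meet W Y) → ∀ C → T (nbr Y C) → ¬ T (nbr W C) →
    count (λ z → mem z C ∧ (not (mem z Y) ∧ not (mem z W))) ≡ k ∸ 1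
  outside-points Y W W∩Y=∅ C YC ¬WC = begin
      count (λ z → mem z C ∧ (not (mem z Y) ∧ not (mem z W)))
        ≡⟨ count-ext (λ z t → T-∧ (T-∧₁ {mem z C} t) (T-∧₁ {not (mem z Y)} (T-∧₂ {mem z C} t)))
                     (λ z t → T-∧ (T-∧₁ {mem z C} t)
                                  (T-∧ (T-∧₂ {mem z C} t) (T-not (off-W z (T-∧₁ {mem z C} t))))) ⟩
      count (λ z → mem z C ∧ not (mem z Y))
        ≡⟨ cong (_∸ 1) (begin
             suc (count (λ z → mem z C ∧ not (mem z Y)))
               ≡⟨ cong (_+ count (λ z → mem z C ∧ not (mem z Y))) (sym (common-one C≢Y (meet-sym (nbr-meet {Y} YC)))) ⟩
             count (λ z → mem z C ∧ mem z Y) + count (λ z → mem z C ∧ not (mem z Y))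
               ≡⟨ sym (count-split (λ z → mem z C) (λ z → mem z Y)) ⟩
             count (λ z → mem z C)
               ≡⟨ block-size C ⟩
             k ∎) ⟩
      k ∸ 1 ∎
    where
      open ≡-Reasoning
      C≢Y : C ≢ Y
      C≢Y C≡Y = nbr-distinct {Y} YC (sym C≡Y)
      off-W : ∀ z → T (mem z C) → ¬ T (mem z W)
      off-W z zC zW = contradiction-for (W ≟ C)
        where
          contradiction-for : Dec (W ≡ C) → ⊥
          contradiction-for (yes W≡C) =
            W∩Y=∅ (subst (λ B → T (meet B Y)) (sym W≡C) (meet-sym (nbr-meet {Y} YC)))
          contradiction-for (no W≢C) = ¬WC (nbr-intro W≢C (meet-intro z zW zC))

  module DisjointBlocks (X R : Fin b) (X∩R=∅ : ¬ T (meet X R)) where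

    open Hall meet X using (Nb; Nb-intro; Nb-mono; NbIn; HallCondition)

    outside : Fin v → Bool
    outside z = not (mem z X) ∧ not (mem z R)

    -- a point z off X and R lies on as many blocks meeting X but not R as
    -- blocks meeting R but not X, since it lies on k blocks meeting each
    balance : ∀ z → T (outside z) →
      count (λ C → (mem z C ∧ meet C X) ∧ not (meet C R)) ≡
      count (λ C → (mem z C ∧ meet C R) ∧ not (meet C X))
    balance z out = +-cancelˡ-≡ (count (λ C → (mem z C ∧ meet C X) ∧ meet C R)) _ _ (begin
        count (λ C → (mem z C ∧ meet C X) ∧ meet C R) + count (λ C → (mem z C ∧ meet C X) ∧ not (meet C R))
          ≡⟨ sym (count-split (λ C → mem z C ∧ meet C X) (λ C → meet C R)) ⟩
        count (λ C → mem z C ∧ meet C X)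
          ≡⟨ through-meeting z X (T-not⁻ (T-∧₁ {not (mem z X)} out)) ⟩
        k
          ≡⟨ sym (through-meeting z R (T-not⁻ (T-∧₂ {not (mem z X)} out))) ⟩
        count (λ C → mem z C ∧ meet C R)
          ≡⟨ count-split (λ C → mem z C ∧ meet C R) (λ C → meet C X) ⟩
        count (λ C → (mem z C ∧ meet C R) ∧ meet C X) + count (λ C → (mem z C ∧ meet C R) ∧ not (meet C X))
          ≡⟨ cong (_+ count (λ C → (mem z C ∧ meet C R) ∧ not (meet C X))) (count-ext swap swap) ⟩
        count (λ C → (mem z C ∧ meet C X) ∧ meet C R) + count (λ C → (mem z C ∧ meet C R) ∧ not (meet C X)) ∎)
      where
        open ≡-Reasoning
        swap : ∀ {Y W} C → T ((mem z C ∧ meet C Y) ∧ meet C W) → T ((mem z C ∧ meet C W) ∧ meet C Y)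
        swap {Y} {W} C t = T-∧ (T-∧ (T-∧₁ {mem z C} (T-∧₁ {mem z C ∧ meet C Y} t)) (T-∧₂ {mem z C ∧ meet C Y} t))
                               (T-∧₂ {mem z C} (T-∧₁ {mem z C ∧ meet C Y} t))

    not-through : ∀ {z C Y} → T (mem z C) → ¬ T (mem z Y) → C ≢ Y
    not-through {z} zC z∉Y C≡Y = z∉Y (subst (λ B → T (mem z B)) C≡Y zC)

    stranded : (Fin b → Bool) → Fin b → Bool
    stranded S C = S C ∧ not (nbr R C)

    reached : (Fin b → Bool) → Fin b → Bool
    reached S E = (nbr R E ∧ Nb (stranded S) E) ∧ not (nbr X E)

    stranded-points : ∀ S → (∀ C → T (S C) → T (nbr X C)) →
      ∀ C → T (stranded S C) → count (λ z → mem z C ∧ outside z) ≡ k ∸ 1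
    stranded-points S S⊆N[X] C t =
      outside-points X R (X∩R=∅ ∘ meet-sym) C (S⊆N[X] C (T-∧₁ {S C} t)) (T-not⁻ (T-∧₂ {S C} t))

    reached-points : ∀ S E → T (reached S E) → count (λ z → mem z E ∧ outside z) ≡ k ∸ 1
    reached-points S E t = trans (count-ext swap swap)
      (outside-points R X X∩R=∅ E (T-∧₁ {nbr R E} (T-∧₁ {nbr R E ∧ Nb (stranded S) E} t))
                      (T-not⁻ (T-∧₂ {nbr R E ∧ Nb (stranded S) E} t)))
      where
        swap : ∀ {Y W : Fin b} z → T (mem z E ∧ (not (mem z Y) ∧ not (mem z W))) →
               T (mem z E ∧ (not (mem z W) ∧ not (mem z Y)))
        swap {Y} z t = T-∧ (T-∧₁ {mem z E} t) (T-∧ (T-∧₂ {not (mem z Y)} (T-∧₂ {mem z E} t))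
                                                    (T-∧₁ {not (mem z Y)} (T-∧₂ {mem z E} t)))

    -- a point z outside X ∪ R lies on at most as many stranded as reached
    -- blocks: if it lies on a stranded C₀, every block through z meeting R
    -- but not X is reached via C₀, and balance compares the two kinds
    stranded-column : ∀ S → (∀ C → T (S C) → T (nbr X C)) → ∀ z → T (outside z) →
      count (λ C → stranded S C ∧ mem z C) ≤ count (λ E → reached S E ∧ mem z E)
    stranded-column S S⊆N[X] z out with search (λ C → stranded S C ∧ mem z C)
    ... | inj₂ none = ≤-trans (≤-reflexive (count-none none)) z≤n
    ... | inj₁ (C₀ , t₀) = begin
        count (λ C → stranded S C ∧ mem z C)
          ≤⟨ count-mono meets-only-X ⟩
        count (λ C → (mem z C ∧ meet C X) ∧ not (meet C R))
          ≡⟨ balance z out ⟩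
        count (λ E → (mem z E ∧ meet E R) ∧ not (meet E X))
          ≤⟨ count-mono is-reached ⟩
        count (λ E → reached S E ∧ mem z E) ∎
      where
        open ≤-Reasoning
        z∉R : ¬ T (mem z R)
        z∉R = T-not⁻ (T-∧₂ {not (mem z X)} out)
        meets-only-X : ∀ C → T (stranded S C ∧ mem z C) → T ((mem z C ∧ meet C X) ∧ not (meet C R))
        meets-only-X C t = T-∧ (T-∧ zC (meet-sym (nbr-meet {X} (S⊆N[X] C (T-∧₁ {S C} st)))))
                               (T-not λ CR → T-not⁻ (T-∧₂ {S C} st)
                                               (nbr-intro (not-through zC z∉R ∘ sym) (meet-sym CR)))
          where
            st = T-∧₁ {stranded S C} t
            zC = T-∧₂ {stranded S C} t
        is-reached : ∀ E → T ((mem z E ∧ meet E R) ∧ not (meet E X)) → T (reached S E ∧ mem z E)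
        is-reached E t = T-∧ (T-∧ (T-∧ (nbr-intro (not-through zE z∉R ∘ sym) (meet-sym ER))
                                         (Nb-intro (stranded S) C₀ E (T-∧₁ {stranded S C₀} t₀)
                                                   (meet-intro z (T-∧₂ {stranded S C₀} t₀) zE)))
                                  (T-not (λ XE → T-not⁻ (T-∧₂ {mem z E ∧ meet E R} t) (meet-sym (nbr-meet {X} XE)))))
                             zE
          where
            zE = T-∧₁ {mem z E} (T-∧₁ {mem z E ∧ meet E R} t)
            ER = T-∧₂ {mem z E} (T-∧₁ {mem z E ∧ meet E R} t)

    -- Weighted double counting over the points outside X ∪ R: there are no
    -- more stranded blocks than reached ones.
    stranded-bound : ∀ S → (∀ C → T (S C) → T (nbr X C)) → count (stranded S) ≤ count (reached S)
    stranded-bound S S⊆N[X] = *-cancelʳ-≤ _ _ (k ∸ 1) {{>-nonZero k-1≥1}} (begin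
        count (stranded S) * (k ∸ 1)
          ≡⟨ sym (incidences-rows (stranded S) outside on (stranded-points S S⊆N[X])) ⟩
        incidences (stranded S) outside on
          ≤⟨ incidences-compare (stranded S) (reached S) outside on (stranded-column S S⊆N[X]) ⟩
        incidences (reached S) outside on
          ≡⟨ incidences-rows (reached S) outside on (reached-points S) ⟩
        count (reached S) * (k ∸ 1) ∎)
      where
        open ≤-Reasoning
        on : Fin b → Fin v → Bool
        on C z = mem z C

    -- Hall's condition: S ⊆ N(X) splits into the blocks of S adjacent to R,
    -- each a neighbour of itself, and the stranded ones, bounded above.
    hall-condition : HallCondition (nbr X) (nbr R)
    hall-condition S S⊆N[X] = begin
        count S
          ≡⟨ count-split S (nbr R) ⟩
        count (λ C → S C ∧ nbr R C) + count (stranded S)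
          ≤⟨ +-mono-≤ (count-mono stays) (≤-trans (stranded-bound S S⊆N[X]) (count-mono moves)) ⟩
        count (λ E → NbIn (nbr R) S E ∧ nbr X E) + count (λ E → NbIn (nbr R) S E ∧ not (nbr X E))
          ≡⟨ sym (count-split (NbIn (nbr R) S) (nbr X)) ⟩
        count (NbIn (nbr R) S) ∎
      where
        open ≤-Reasoning
        stays : ∀ C → T (S C ∧ nbr R C) → T (NbIn (nbr R) S C ∧ nbr X C)
        stays C t = T-∧ (T-∧ (T-∧₂ {S C} t) (Nb-intro S C C (T-∧₁ {S C} t) (meet-refl C)))
                        (S⊆N[X] C (T-∧₁ {S C} t))
        moves : ∀ E → T (reached S E) → T (NbIn (nbr R) S E ∧ not (nbr X E))
        moves E t = T-∧ (T-∧ (T-∧₁ {nbr R E} (T-∧₁ {nbr R E ∧ Nb (stranded S) E} t))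
                             (Nb-mono (λ C → T-∧₁ {S C}) E (T-∧₂ {nbr R E} (T-∧₁ {nbr R E ∧ Nb (stranded S) E} t))))
                        (T-∧₂ {nbr R E ∧ Nb (stranded S) E} t)

    -- Hall's theorem, together with the equal degrees of X and R, gives a
    -- bijection φ from the neighbours of X onto those of R with each C
    -- meeting φ C.
    redeployment : Σ (Fin b → Fin b) λ φ →
      (∀ C → T (nbr X C) → T (meet C (φ C))) × (∀ E → T (nbr R E) → ∃ λ C → T (nbr X C) × φ C ≡ E)
    redeployment = φ , (λ C t → proj₂ (valid C t)) ,
      injection-onto φ (nbr X) (nbr R) (λ C t → proj₁ (valid C t)) (proj₂ (proj₂ matching))
                     (≤-reflexive (trans (degree-nbr R) (sym (degree-nbr X))))
      where
        matching : Hall.Matching meet X (nbr X) (nbr R)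
        matching = Hall.hall meet X b (nbr X) (nbr R) (count≤size (nbr X)) hall-condition
        φ : Fin b → Fin b
        φ = proj₁ matching
        valid : ∀ C → T (nbr X C) → T (nbr R (φ C)) × T (meet C (φ C))
        valid = proj₁ (proj₂ matching)

  open Surrounding (BlockAdj D) nbr nbr-sound nbr-complete using (Redeployable)

  meet-step : ∀ {C E} → T (meet C E) → E ≡ C ⊎ BlockAdj D C E
  meet-step {C} {E} t with C ≟ E
  ... | yes C≡E = inj₁ (sym C≡E)
  ... | no C≢E = inj₂ (nbr-sound (nbr-intro C≢E t))

  redeployable : ∀ X R → R ≢ X → ¬ BlockAdj D X R → Redeployable X R
  redeployable X R R≢X ¬XR = φ , (λ C XC → meet-step (meets C (nbr-complete XC))) ,
    λ E RE → let (C , XC , φC≡E) = onto E (nbr-complete RE) in C , nbr-sound XC , φC≡E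
    where
      X∩R=∅ : ¬ T (meet X R)
      X∩R=∅ t = ¬XR (nbr-sound (nbr-intro (R≢X ∘ sym) t))
      open DisjointBlocks X R X∩R=∅ using (redeployment)
      φ = proj₁ redeployment
      meets = proj₁ (proj₂ redeployment)
      onto = proj₂ (proj₂ redeployment)

  -- r ≥ 2, since (k - 1) r = v - 1 > k - 1
  r≥2 : 2 ≤ r
  r≥2 with r ≤? 1
  ... | no r≰1 = ≰⇒> r≰1
  ... | yes r≤1 = ⊥-elim (<⇒≱ (∸-monoˡ-< v>k k≥1) (begin
      v ∸ 1        ≡⟨ sym replication ⟩
      (k ∸ 1) * r  ≤⟨ *-monoʳ-≤ (k ∸ 1) r≤1 ⟩
      (k ∸ 1) * 1  ≡⟨ *-identityʳ (k ∸ 1) ⟩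
      k ∸ 1        ∎))
    where open ≤-Reasoning

  degree-positive : 1 ≤ k * (r ∸ 1)
  degree-positive = *-mono-≤ k≥1 (∸-monoˡ-≤ 1 r≥2)

  some-block : Fin b
  some-block = proj₁ (joining-block (fromℕ< 0<v) (fromℕ< 1<v) 0≢1)
    where
      1<v : 1 < v
      1<v = ≤-trans (s≤s k≥1) v>k
      0<v : 0 < v
      0<v = ≤-trans (s≤s z≤n) 1<v
      0≢1 : fromℕ< 0<v ≢ fromℕ< 1<v
      0≢1 e = 0≢1+n (trans (sym (toℕ-fromℕ< 0<v)) (trans (cong toℕ e) (toℕ-fromℕ< 1<v)))

theorem25 : ∀ {v k : ℕ} (D : BIBD v k) (r : ℕ) → (k ∸ 1) * r ≡ v ∸ 1 →
    Game.SurroundingCopNumber (BlockAdj D) (k * (r ∸ 1))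
theorem25 D r replication =
  surrounding-cop-number some-block degree-positive degree-nbr (redeployable some-block)
  where
    open BlockDesign D r replication
    open Surrounding (BlockAdj D) nbr nbr-sound nbr-complete using (surrounding-cop-number)
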